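{- Let $C\subseteq\{N,H,D,R,L,Fa,Fu\}$. Then $\{\Gamma_i\Rightarrow\Delta_i\}_{i\in I}\vdash_{\mathbf{STL}(C)}\Gamma\Rightarrow\Delta$ iff $\{\Gamma_i\Rightarrow\Delta_i\}_{i\in I}\vDash_{\mathcal{CV}(C)}\Gamma\Rightarrow\Delta$, where $\mathcal{CV}(C)$ is the class of all $\nabla$-algebras in $\mathcal{V}(C)$ whose underlying lattice is complete.
   Context: \textbf{Calculus.} Language $\{\wedge,\vee,\to,\top,\bot,\nabla\}$, plus $\supset$ if $H\in C$. Sequents are $\Gamma\Rightarrow\Delta$ with finite multisets and $|\Delta|\le1$; $\nabla\Gamma=\{\nabla\gamma\mid\gamma\in\Gamma\}$. $\mathbf{STL}$ rules (premises / conclusion): - Axioms: $A\Rightarrow A$; $\bot\Rightarrow$; $\Rightarrow\top$. - Weakening: $\Gamma\Rightarrow\Delta$ / $\Gamma,A\Rightarrow\Delta$; $\Gamma\Rightarrow$ / $\Gamma\Rightarrow A$. - Contraction: $\Gamma,A,A\Rightarrow\Delta$ / $\Gamma,A\Rightarrow\Delta$. - Cut: $\Gamma\Rightarrow A$, $\Pi,A\Rightarrow\Delta$ / $\Pi,\Gamma\Rightarrow\Delta$. - Conjunction: left rules for either conjunct; $\Gamma\Rightarrow A$, $\Gamma\Rightarrow B$ / $\Gamma\Rightarrow A\wedge B$. - Disjunction: $A\Rightarrow\Delta$, $B\Rightarrow\Delta$ / $A\vee B\Rightarrow\Delta$; right rules for either disjunct. - Modality: $A\Rightarrow B$ / $\nabla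 A\Rightarrow\nabla B$. - Left implication: $\Gamma\Rightarrow A$, $\Gamma,B\Rightarrow\Delta$ / $\Gamma,\nabla(A\to B)\Rightarrow\Delta$. - Right implication: $\nabla\Gamma,A\Rightarrow B$ / $\Gamma\Rightarrow A\to B$. Additional rules: - (R): $\Gamma\Rightarrow A$ / $\Gamma\Rightarrow\nabla A$. - (L): $\Gamma,A\Rightarrow\Delta$ / $\Gamma,\nabla A\Rightarrow\Delta$. - (D): $\Gamma,A\Rightarrow\Delta$, $\Gamma,B\Rightarrow\Delta$ / $\Gamma,A\vee B\Rightarrow\Delta$. - (N): $\Gamma\Rightarrow\Delta$ / $\nabla\Gamma\Rightarrow\nabla\Delta$. - (Fa): $\Gamma,A\Rightarrow B$ / $\Gamma\Rightarrow\nabla(A\to B)$. - (Fu): $\nabla\Gamma\Rightarrow A$, $\nabla\Gamma,B\Rightarrow\nabla\Delta$ / $\Gamma,A\to B\Rightarrow\Delta$. - (H): intuitionistic rules for $\supset$: $\Gamma\Rightarrow A$, $\Gamma,B\Rightarrow\Delta$ / $\Gamma,A\supset B\Rightarrow\Delta$ and $\Gamma,A\Rightarrow B$ / $\Gamma\Rightarrow A\supset B$. \textbf{Algebras.} A $\nabla$-algebra is $(\mathsf{A},\nabla,\to)$ with $\mathsf{A}$ a bounded lattice and $\nabla c\wedge a\le b$ iff $c\le a\to b$. Properties: - N: $\nabla1=1$, $\nabla(a\wedge b)=\nabla a\wedge\nabla b$. - H: $\mathsf{A}$ Heyting. - D: distributive. - R: $a\le\nabla a$. - L: $\nabla a\le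 a$. - Fa: $\nabla$ surjective. - Fu: $a\mapsto1\to a$ surjective. $\mathcal{V}(C)$ is the class satisfying $C$. \textbf{Semantics.} Algebraic models interpret connectives homomorphically ($\supset$ as the Heyting implication). $\Gamma\Rightarrow\Delta$ holds if $\bigwedge V[\Gamma]\le\bigvee V[\Delta]$. $\mathcal{S}\vDash_{\mathfrak{C}}S$ means every model over an algebra in $\mathfrak{C}$ validating $\mathcal{S}$ validates $S$. -}

module Defs where

open import Level using (Level; _⊔_) renaming (suc to lsuc)
open import Data.Bool using (Bool; true; false; T)
open import Data.Nat using (ℕ)
open import Data.List using (List; []; _∷_; _++_; foldr) renaming (map to lmap)
open import Data.Maybe using (Maybe; just; nothing; maybe) renaming (map to mmap)
open import Data.Product using (Σ; _×_; _,_; proj₁)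
open import Relation.Binary.Lattice.Bundles using (BoundedLattice)
open import Data.List.Relation.Binary.Permutation.Propositional using (_↭_)

-- The set C ⊆ {N,H,D,R,L,Fa,Fu}, as a record of membership flags.

record Flags : Set where
  field
    N H D R L Fa Fu : Bool

-- Formulas.  Propositional variables are indexed by ℕ.  The index b says
-- whether the Heyting implication ⊃ is in the language; the ⊃ constructor
-- requires a (unique) proof of T b.

infixr 7 _∧ᶠ_
infixr 6 _∨ᶠ_
infixr 5 _→ᶠ_

data Fm (b : Bool) : Set where
  var   : ℕ → Fm b
  ⊤ᶠ ⊥ᶠ : Fm b
  _∧ᶠ_ _∨ᶠ_ _→ᶠ_ : Fm b → Fm b → Fm b
  ∇ᶠ    : Fm b → Fm b
  imp   : T b → Fm b → Fm b → Fm b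

-- Sequents Γ ⇒ Δ with Γ a finite multiset (list up to permutation, see
-- the exchange rule) and |Δ| ≤ 1 (Maybe).
record Sequent (b : Bool) : Set where
  constructor _⇛_
  field
    ant : List (Fm b)
    suc : Maybe (Fm b)

infix 3 _⇛_

∇L : ∀ {b} → List (Fm b) → List (Fm b)
∇L = lmap ∇ᶠ

∇M : ∀ {b} → Maybe (Fm b) → Maybe (Fm b)
∇M = mmap ∇ᶠ

-- Derivability in STL(C) from hypotheses {hyp i}_{i∈I}.
-- "Γ, A" is written A ∷ Γ; multiset structure via the exchange rule.

data Deriv (C : Flags) {I : Set} (hyp : I → Sequent (Flags.H C))
     : Sequent (Flags.H C) → Set where
  hyp′ : ∀ i → Deriv C hyp (hyp i)
  exch : ∀ {Γ Γ′ Δ} → Γ ↭ Γ′ → Deriv C hyp (Γ ⇛ Δ) → Deriv C hyp (Γ′ ⇛ Δ)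
  ax   : ∀ {A} → Deriv C hyp (A ∷ [] ⇛ just A)
  ⊥ax  : Deriv C hyp (⊥ᶠ ∷ [] ⇛ nothing)
  ⊤ax  : Deriv C hyp ([] ⇛ just ⊤ᶠ)
  wL   : ∀ {Γ Δ A} → Deriv C hyp (Γ ⇛ Δ) → Deriv C hyp (A ∷ Γ ⇛ Δ)
  wR   : ∀ {Γ A} → Deriv C hyp (Γ ⇛ nothing) → Deriv C hyp (Γ ⇛ just A)
  ctr  : ∀ {Γ Δ A} → Deriv C hyp (A ∷ A ∷ Γ ⇛ Δ) → Deriv C hyp (A ∷ Γ ⇛ Δ)
  cut  : ∀ {Γ Π Δ A} → Deriv C hyp (Γ ⇛ just A) → Deriv C hyp (A ∷ Π ⇛ Δ)
       → Deriv C hyp (Π ++ Γ ⇛ Δ)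
  ∧L₁  : ∀ {Γ Δ A B} → Deriv C hyp (A ∷ Γ ⇛ Δ) → Deriv C hyp ((A ∧ᶠ B) ∷ Γ ⇛ Δ)
  ∧L₂  : ∀ {Γ Δ A B} → Deriv C hyp (B ∷ Γ ⇛ Δ) → Deriv C hyp ((A ∧ᶠ B) ∷ Γ ⇛ Δ)
  ∧R   : ∀ {Γ A B} → Deriv C hyp (Γ ⇛ just A) → Deriv C hyp (Γ ⇛ just B)
       → Deriv C hyp (Γ ⇛ just (A ∧ᶠ B))
  ∨L   : ∀ {Δ A B} → Deriv C hyp (A ∷ [] ⇛ Δ) → Deriv C hyp (B ∷ [] ⇛ Δ)
       → Deriv C hyp ((A ∨ᶠ B) ∷ [] ⇛ Δ)
  ∨R₁  : ∀ {Γ A B} → Deriv C hyp (Γ ⇛ just A) → Deriv C hyp (Γ ⇛ just (A ∨ᶠ B))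
  ∨R₂  : ∀ {Γ A B} → Deriv C hyp (Γ ⇛ just B) → Deriv C hyp (Γ ⇛ just (A ∨ᶠ B))
  ∇mon : ∀ {A B} → Deriv C hyp (A ∷ [] ⇛ just B)
       → Deriv C hyp (∇ᶠ A ∷ [] ⇛ just (∇ᶠ B))
  →L   : ∀ {Γ Δ A B} → Deriv C hyp (Γ ⇛ just A) → Deriv C hyp (B ∷ Γ ⇛ Δ)
       → Deriv C hyp (∇ᶠ (A →ᶠ B) ∷ Γ ⇛ Δ)
  →R   : ∀ {Γ A B} → Deriv C hyp (A ∷ ∇L Γ ⇛ just B)
       → Deriv C hyp (Γ ⇛ just (A →ᶠ B))
  ruleR : T (Flags.R C) → ∀ {Γ A} → Deriv C hyp (Γ ⇛ just A)
        → Deriv C hyp (Γ ⇛ just (∇ᶠ A))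
  ruleL : T (Flags.L C) → ∀ {Γ Δ A} → Deriv C hyp (A ∷ Γ ⇛ Δ)
        → Deriv C hyp (∇ᶠ A ∷ Γ ⇛ Δ)
  ruleD : T (Flags.D C) → ∀ {Γ Δ A B} → Deriv C hyp (A ∷ Γ ⇛ Δ)
        → Deriv C hyp (B ∷ Γ ⇛ Δ) → Deriv C hyp ((A ∨ᶠ B) ∷ Γ ⇛ Δ)
  ruleN : T (Flags.N C) → ∀ {Γ Δ} → Deriv C hyp (Γ ⇛ Δ)
        → Deriv C hyp (∇L Γ ⇛ ∇M Δ)
  ruleFa : T (Flags.Fa C) → ∀ {Γ A B} → Deriv C hyp (A ∷ Γ ⇛ just B)
         → Deriv C hyp (Γ ⇛ just (∇ᶠ (A →ᶠ B)))
  ruleFu : T (Flags.Fu C) → ∀ {Γ Δ A B} → Deriv C hyp (∇L Γ ⇛ just A)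
         → Deriv C hyp (B ∷ ∇L Γ ⇛ ∇M Δ) → Deriv C hyp ((A →ᶠ B) ∷ Γ ⇛ Δ)
  ⊃L : (h : T (Flags.H C)) → ∀ {Γ Δ A B} → Deriv C hyp (Γ ⇛ just A)
     → Deriv C hyp (B ∷ Γ ⇛ Δ) → Deriv C hyp (imp h A B ∷ Γ ⇛ Δ)
  ⊃R : (h : T (Flags.H C)) → ∀ {Γ A B} → Deriv C hyp (A ∷ Γ ⇛ just B)
     → Deriv C hyp (Γ ⇛ just (imp h A B))

record NablaAlgebra (c ℓ₁ ℓ₂ : Level) : Set (lsuc (c ⊔ ℓ₁ ⊔ ℓ₂)) where
  field
    boundedLattice : BoundedLattice c ℓ₁ ℓ₂
  open BoundedLattice boundedLattice public
  field
    ∇    : Carrier → Carrier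
    _⇝_  : Carrier → Carrier → Carrier
    adj  : ∀ a b c → ((∇ c ∧ a) ≤ b → c ≤ (a ⇝ b)) × (c ≤ (a ⇝ b) → (∇ c ∧ a) ≤ b)

IsComplete : ∀ {c ℓ₁ ℓ₂} (ι : Level) → NablaAlgebra c ℓ₁ ℓ₂ → Set (c ⊔ ℓ₂ ⊔ lsuc ι)
IsComplete ι A = ∀ {J : Set ι} (f : J → Carrier) →
  Σ Carrier λ s → (∀ j → f j ≤ s) × (∀ u → (∀ j → f j ≤ u) → s ≤ u)
  where open NablaAlgebra A

-- Membership in V(C).  For H, a witness of the Heyting implication is
-- required; it is used to interpret ⊃.
record InV {c ℓ₁ ℓ₂} (C : Flags) (A : NablaAlgebra c ℓ₁ ℓ₂) : Set (c ⊔ ℓ₁ ⊔ ℓ₂) where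
  open NablaAlgebra A
  field
    propN  : T (Flags.N C) → (∇ ⊤ ≈ ⊤) × (∀ a b → ∇ (a ∧ b) ≈ (∇ a ∧ ∇ b))
    propH  : T (Flags.H C) → Σ (Carrier → Carrier → Carrier) λ _⊃_ →
               ∀ a b c → ((c ∧ a) ≤ b → c ≤ (a ⊃ b)) × (c ≤ (a ⊃ b) → (c ∧ a) ≤ b)
    propD  : T (Flags.D C) → ∀ a b c → (a ∧ (b ∨ c)) ≤ ((a ∧ b) ∨ (a ∧ c))
    propR  : T (Flags.R C) → ∀ a → a ≤ ∇ a
    propL  : T (Flags.L C) → ∀ a → ∇ a ≤ a
    propFa : T (Flags.Fa C) → ∀ b → Σ Carrier λ a → ∇ a ≈ b
    propFu : T (Flags.Fu C) → ∀ b → Σ Carrier λ a → (⊤ ⇝ a) ≈ b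

module Semantics {c ℓ₁ ℓ₂} {C : Flags} (A : NablaAlgebra c ℓ₁ ℓ₂) (inV : InV C A)
                 (v : ℕ → NablaAlgebra.Carrier A) where
  open NablaAlgebra A

  ⟦_⟧ : Fm (Flags.H C) → Carrier
  ⟦ var n ⟧     = v n
  ⟦ ⊤ᶠ ⟧        = ⊤
  ⟦ ⊥ᶠ ⟧        = ⊥
  ⟦ a ∧ᶠ b ⟧    = ⟦ a ⟧ ∧ ⟦ b ⟧
  ⟦ a ∨ᶠ b ⟧    = ⟦ a ⟧ ∨ ⟦ b ⟧
  ⟦ a →ᶠ b ⟧    = ⟦ a ⟧ ⇝ ⟦ b ⟧
  ⟦ ∇ᶠ a ⟧      = ∇ ⟦ a ⟧
  ⟦ imp h a b ⟧ = proj₁ (InV.propH inV h) ⟦ a ⟧ ⟦ b ⟧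

  Holds : Sequent (Flags.H C) → Set ℓ₂
  Holds (Γ ⇛ Δ) = foldr (λ x r → ⟦ x ⟧ ∧ r) ⊤ Γ ≤ maybe ⟦_⟧ ⊥ Δ

-- Semantic consequence w.r.t. CV(C): all complete ∇-algebras in V(C)
-- (carrier in Set (suc ℓ), ≈ and ≤ in Set ℓ, joins of Set ℓ-indexed families).
SemCons : (ℓ : Level) (C : Flags) {I : Set} → (I → Sequent (Flags.H C))
        → Sequent (Flags.H C) → Set (lsuc (lsuc ℓ))
SemCons ℓ C {I} hyp S =
  (A : NablaAlgebra (lsuc ℓ) ℓ ℓ) → IsComplete ℓ A → (inV : InV C A) →
  (v : ℕ → NablaAlgebra.Carrier A) →
  (∀ i → Semantics.Holds A inV v (hyp i)) → Semantics.Holds A inV v S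

{-# OPTIONS --safe #-}
-- Soundness is checked rule by rule: each optional rule is valid under its algebraic property,
-- the only subtle case being Fu, where surjectivity of ⊤ ⇝ _ makes ∇ reflect ≤.
-- Completeness needs a single model, the ideal completion of the Lindenbaum preorder a ⊢ b
-- (derivability from the hypotheses).  Ideals (down-closed, containing ⊥, closed under ∨) form a
-- complete lattice, with ∇Z = {x | x ⊢ ∇z for some z ∈ Z} and X ⇝ Y = {c | ∇c ∧ a ∈ Y for all
-- a ∈ X}.  Each rule of STL(C) yields the matching property of V(C) in this algebra, and with
-- v(p) = ↓p the truth lemma ⟦A⟧ = ↓A shows that a sequent holds in the model iff it is
-- derivable; so the hypotheses hold there, and every semantic consequence is derivable.
module Submission where

open import Defs
open import Level using (Level; Lift; lift; lower) renaming (suc to lsuc)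
open import Function using (_∘_; id)
open import Data.Bool using (T)
open import Data.Nat using (ℕ)
open import Data.Unit.Polymorphic using (tt) renaming (⊤ to Unit)
open import Data.List using (List; []; _∷_; _++_; foldr)
open import Data.List.Properties using (foldr-map)
open import Data.List.Relation.Unary.All using (All; []; _∷_)
open import Data.List.Relation.Binary.Permutation.Propositional as Perm using (_↭_; ↭-sym)
open import Data.List.Relation.Binary.Permutation.Propositional.Properties using (∷↭∷ʳ)
open import Data.Maybe using (Maybe; just; nothing; maybe)
open import Data.Product using (Σ; _×_; _,_; proj₁; proj₂)
import Relation.Binary.PropositionalEquality as ≡
open import Relation.Binary.Structures using (IsEquivalence; IsPartialOrder)
open import Relation.Binary.Lattice.Bundles using (BoundedLattice)
import Relation.Binary.Lattice.Properties.MeetSemilattice as MeetSemilatticeProperties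

module BoundedLatticeProperties {c ℓ₁ ℓ₂} (L : BoundedLattice c ℓ₁ ℓ₂) where
  open BoundedLattice L
  open MeetSemilatticeProperties meetSemilattice using (∧-monotonic; ∧-comm)

  ∧-swap : ∀ x y → x ∧ y ≤ y ∧ x
  ∧-swap x y = reflexive (∧-comm x y)

  x≤x∧⊤ : ∀ {x} → x ≤ x ∧ ⊤
  x≤x∧⊤ = ∧-greatest refl (maximum _)

  ∧-cut : ∀ {a b d e g} → e ∧ a ≤ b → g ≤ a → b ∧ g ≤ d → e ∧ g ≤ d
  ∧-cut e∧a≤b g≤a b∧g≤d =
    trans (∧-greatest (trans (∧-monotonic refl g≤a) e∧a≤b) (x∧y≤y _ _)) b∧g≤d

  distributive⇒∨-elim : (∀ a b c → a ∧ (b ∨ c) ≤ (a ∧ b) ∨ (a ∧ c)) →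
                        ∀ {a b d g} → a ∧ g ≤ d → b ∧ g ≤ d → (a ∨ b) ∧ g ≤ d
  distributive⇒∨-elim distrib {a} {b} {g = g} a∧g≤d b∧g≤d =
    trans (∧-swap _ _) (trans (distrib g a b)
      (∨-least (trans (∧-swap g a) a∧g≤d) (trans (∧-swap g b) b∧g≤d)))

  module _ {a} {X : Set a} (f : X → Carrier) where

    ⨅ : List X → Carrier
    ⨅ = foldr (λ x r → f x ∧ r) ⊤

    ⨅-++ˡ : ∀ Π Γ → ⨅ (Π ++ Γ) ≤ ⨅ Π
    ⨅-++ˡ []      Γ = maximum _
    ⨅-++ˡ (x ∷ Π) Γ = ∧-monotonic refl (⨅-++ˡ Π Γ)

    ⨅-++ʳ : ∀ Π Γ → ⨅ (Π ++ Γ) ≤ ⨅ Γ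
    ⨅-++ʳ []      Γ = refl
    ⨅-++ʳ (x ∷ Π) Γ = trans (x∧y≤y _ _) (⨅-++ʳ Π Γ)

    ⨅-↭ : ∀ {Γ Γ′} → Γ ↭ Γ′ → ⨅ Γ′ ≤ ⨅ Γ
    ⨅-↭ Perm.refl          = refl
    ⨅-↭ (Perm.prep x p)    = ∧-monotonic refl (⨅-↭ p)
    ⨅-↭ (Perm.swap x y p)  =
      ∧-greatest (trans (x∧y≤y _ _) (x∧y≤x _ _))
                 (∧-monotonic refl (trans (x∧y≤y _ _) (⨅-↭ p)))
    ⨅-↭ (Perm.trans p q)   = trans (⨅-↭ q) (⨅-↭ p)

module NablaAlgebraProperties {c ℓ₁ ℓ₂} (𝔸 : NablaAlgebra c ℓ₁ ℓ₂) where
  open NablaAlgebra 𝔸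
  open BoundedLatticeProperties boundedLattice
  open MeetSemilatticeProperties meetSemilattice using (∧-monotonic)
  open import Relation.Binary.Reasoning.PartialOrder poset

  ⇝-curry : ∀ {a b c} → ∇ c ∧ a ≤ b → c ≤ a ⇝ b
  ⇝-curry = proj₁ (adj _ _ _)

  ⇝-eval : ∀ {a b} → ∇ (a ⇝ b) ∧ a ≤ b
  ⇝-eval = proj₂ (adj _ _ _) refl

  -- ∇ is left adjoint to ⊤ ⇝ _.
  ∇-transpose : ∀ {b c} → ∇ c ≤ b → c ≤ ⊤ ⇝ b
  ∇-transpose ∇c≤b = ⇝-curry (trans (x∧y≤x _ _) ∇c≤b)

  ∇-untranspose : ∀ {b c} → c ≤ ⊤ ⇝ b → ∇ c ≤ b
  ∇-untranspose c≤⊤⇝b = trans x≤x∧⊤ (proj₂ (adj _ _ _) c≤⊤⇝b)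

  ∇-mono : ∀ {a b} → a ≤ b → ∇ a ≤ ∇ b
  ∇-mono a≤b = ∇-untranspose (trans a≤b (∇-transpose refl))

  ∇⊥≤⊥ : ∇ ⊥ ≤ ⊥
  ∇⊥≤⊥ = ∇-untranspose (minimum _)

  ∇-⨅ : ∀ {a} {X : Set a} (f : X → Carrier) Γ → ∇ (⨅ f Γ) ≤ ⨅ (∇ ∘ f) Γ
  ∇-⨅ f []      = maximum _
  ∇-⨅ f (x ∷ Γ) = ∧-greatest (∇-mono (x∧y≤x _ _)) (trans (∇-mono (x∧y≤y _ _)) (∇-⨅ f Γ))

  ⨅-∇ : (∇ ⊤ ≈ ⊤) × (∀ a b → ∇ (a ∧ b) ≈ ∇ a ∧ ∇ b) →
        ∀ {a} {X : Set a} (f : X → Carrier) Γ → ⨅ (∇ ∘ f) Γ ≤ ∇ (⨅ f Γ)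
  ⨅-∇ (∇⊤≈⊤ , ∇-∧) f []      = reflexive (Eq.sym ∇⊤≈⊤)
  ⨅-∇ (∇⊤≈⊤ , ∇-∧) f (x ∷ Γ) =
    trans (∧-monotonic refl (⨅-∇ (∇⊤≈⊤ , ∇-∧) f Γ)) (reflexive (Eq.sym (∇-∧ _ _)))

  ∇-surjective⇒⇝-intro : (∀ b → Σ Carrier λ a → ∇ a ≈ b) →
                         ∀ {a b c} → a ∧ c ≤ b → c ≤ ∇ (a ⇝ b)
  ∇-surjective⇒⇝-intro surj {a} {b} {c} a∧c≤b with surj c
  ... | z , ∇z≈c = begin
    c           ≈⟨ ∇z≈c ⟨
    ∇ z         ≤⟨ ∇-mono (⇝-curry (begin
                     ∇ z ∧ a ≤⟨ ∧-swap _ _ ⟩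
                     a ∧ ∇ z ≤⟨ ∧-monotonic refl (reflexive ∇z≈c) ⟩
                     a ∧ c   ≤⟨ a∧c≤b ⟩
                     b       ∎)) ⟩
    ∇ (a ⇝ b)   ∎

  ⊤⇝-surjective⇒∇-reflects-≤ : (∀ b → Σ Carrier λ a → ⊤ ⇝ a ≈ b) →
                               ∀ {x y} → ∇ x ≤ ∇ y → x ≤ y
  ⊤⇝-surjective⇒∇-reflects-≤ surj {x} {y} ∇x≤∇y with surj y
  ... | z , ⊤⇝z≈y = begin
    x       ≤⟨ ∇-transpose (begin
                 ∇ x         ≤⟨ ∇x≤∇y ⟩
                 ∇ y         ≤⟨ ∇-mono (reflexive (Eq.sym ⊤⇝z≈y)) ⟩
                 ∇ (⊤ ⇝ z)   ≤⟨ ∇-untranspose refl ⟩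
                 z           ∎) ⟩
    ⊤ ⇝ z   ≈⟨ ⊤⇝z≈y ⟩
    y       ∎

module Soundness {c ℓ₁ ℓ₂} {C : Flags} (𝔸 : NablaAlgebra c ℓ₁ ℓ₂) (inV : InV C 𝔸)
                 (v : ℕ → NablaAlgebra.Carrier 𝔸) where
  open NablaAlgebra 𝔸
  open InV inV
  open Semantics 𝔸 inV v
  open BoundedLatticeProperties boundedLattice
  open NablaAlgebraProperties 𝔸
  open MeetSemilatticeProperties meetSemilattice using (∧-monotonic)

  ⟦_⟧ᴹ : Maybe (Fm (Flags.H C)) → Carrier
  ⟦_⟧ᴹ = maybe ⟦_⟧ ⊥

  ⨅⟦∇L⟧≡ : ∀ Γ → ⨅ ⟦_⟧ (∇L Γ) ≡.≡ ⨅ (∇ ∘ ⟦_⟧) Γ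
  ⨅⟦∇L⟧≡ = foldr-map _ ∇ᶠ ⊤

  ∇⨅⟦⟧≤⨅⟦∇L⟧ : ∀ Γ → ∇ (⨅ ⟦_⟧ Γ) ≤ ⨅ ⟦_⟧ (∇L Γ)
  ∇⨅⟦⟧≤⨅⟦∇L⟧ Γ = trans (∇-⨅ ⟦_⟧ Γ) (reflexive (Eq.reflexive (≡.sym (⨅⟦∇L⟧≡ Γ))))

  ⨅⟦∇L⟧≤∇⨅⟦⟧ : T (Flags.N C) → ∀ Γ → ⨅ ⟦_⟧ (∇L Γ) ≤ ∇ (⨅ ⟦_⟧ Γ)
  ⨅⟦∇L⟧≤∇⨅⟦⟧ n Γ = trans (reflexive (Eq.reflexive (⨅⟦∇L⟧≡ Γ))) (⨅-∇ (propN n) ⟦_⟧ Γ)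

  ∇⟦⟧ᴹ≤⟦∇M⟧ᴹ : ∀ Δ → ∇ ⟦ Δ ⟧ᴹ ≤ ⟦ ∇M Δ ⟧ᴹ
  ∇⟦⟧ᴹ≤⟦∇M⟧ᴹ (just A) = refl
  ∇⟦⟧ᴹ≤⟦∇M⟧ᴹ nothing  = ∇⊥≤⊥

  ⟦∇M⟧ᴹ≤∇⟦⟧ᴹ : ∀ Δ → ⟦ ∇M Δ ⟧ᴹ ≤ ∇ ⟦ Δ ⟧ᴹ
  ⟦∇M⟧ᴹ≤∇⟦⟧ᴹ (just A) = refl
  ⟦∇M⟧ᴹ≤∇⟦⟧ᴹ nothing  = minimum _

  module _ {I : Set} {hyp : I → Sequent (Flags.H C)} (hyps : ∀ i → Holds (hyp i)) where

    sound : ∀ {S} → Deriv C hyp S → Holds S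
    sound (hyp′ i)       = hyps i
    sound (exch p d)     = trans (⨅-↭ ⟦_⟧ p) (sound d)
    sound ax             = x∧y≤x _ _
    sound ⊥ax            = x∧y≤x _ _
    sound ⊤ax            = refl
    sound (wL d)         = trans (x∧y≤y _ _) (sound d)
    sound (wR d)         = trans (sound d) (minimum _)
    sound (ctr d)        = trans (∧-greatest (x∧y≤x _ _) refl) (sound d)
    sound (cut {Γ} {Π} d e) =
      trans (∧-greatest (trans (⨅-++ʳ ⟦_⟧ Π Γ) (sound d)) (⨅-++ˡ ⟦_⟧ Π Γ)) (sound e)
    sound (∧L₁ d)        = trans (∧-monotonic (x∧y≤x _ _) refl) (sound d)
    sound (∧L₂ d)        = trans (∧-monotonic (x∧y≤y _ _) refl) (sound d)
    sound (∧R d e)       = ∧-greatest (sound d) (sound e)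
    sound (∨L d e)       =
      trans (x∧y≤x _ _) (∨-least (trans x≤x∧⊤ (sound d)) (trans x≤x∧⊤ (sound e)))
    sound (∨R₁ d)        = trans (sound d) (x≤x∨y _ _)
    sound (∨R₂ d)        = trans (sound d) (y≤x∨y _ _)
    sound (∇mon d)       = trans (x∧y≤x _ _) (∇-mono (trans x≤x∧⊤ (sound d)))
    sound (→L d e)       = ∧-cut ⇝-eval (sound d) (sound e)
    sound (→R {Γ} d)     =
      ⇝-curry (trans (∧-swap _ _) (trans (∧-monotonic refl (∇⨅⟦⟧≤⨅⟦∇L⟧ Γ)) (sound d)))
    sound (ruleR r d)    = trans (sound d) (propR r _)
    sound (ruleL l d)    = trans (∧-monotonic (propL l _) refl) (sound d)
    sound (ruleD δ d e)  = distributive⇒∨-elim (propD δ) (sound d) (sound e)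
    sound (ruleN n {Γ} {Δ} d) =
      trans (⨅⟦∇L⟧≤∇⨅⟦⟧ n Γ) (trans (∇-mono (sound d)) (∇⟦⟧ᴹ≤⟦∇M⟧ᴹ Δ))
    sound (ruleFa fa d)  = ∇-surjective⇒⇝-intro (propFa fa) (sound d)
    sound (ruleFu fu {Γ} {Δ} {A} {B} d e) =
      ⊤⇝-surjective⇒∇-reflects-≤ (propFu fu)
        (trans (∇⨅⟦⟧≤⨅⟦∇L⟧ ((A →ᶠ B) ∷ Γ))
          (trans (∧-cut ⇝-eval (sound d) (sound e)) (⟦∇M⟧ᴹ≤∇⟦⟧ᴹ Δ)))
    sound (⊃L h d e)     = ∧-cut (proj₂ (proj₂ (propH h) _ _ _) refl) (sound d) (sound e)
    sound (⊃R h d)       = proj₁ (proj₂ (propH h) _ _ _) (trans (∧-swap _ _) (sound d))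

module DerivedRules (C : Flags) {I : Set} (hyp : I → Sequent (Flags.H C)) where

  Formula : Set
  Formula = Fm (Flags.H C)

  infix 2 ⊢_
  ⊢_ : Sequent (Flags.H C) → Set
  ⊢_ = Deriv C hyp

  infix 4 _⊢_
  _⊢_ : Formula → Formula → Set
  a ⊢ b = ⊢ a ∷ [] ⇛ just b

  private variable
    a b c d x : Formula
    Γ : List Formula
    Δ : Maybe Formula

  ⊢-trans : a ⊢ b → b ⊢ c → a ⊢ c
  ⊢-trans = cut

  exch-head : ⊢ a ∷ b ∷ Γ ⇛ Δ → ⊢ b ∷ a ∷ Γ ⇛ Δ
  exch-head = exch (Perm.swap _ _ Perm.refl)

  weaken-tail : ∀ Γ → ⊢ a ∷ [] ⇛ Δ → ⊢ a ∷ Γ ⇛ Δ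
  weaken-tail []      d = d
  weaken-tail (b ∷ Γ) d = exch-head (wL (weaken-tail Γ d))

  cut-head : a ⊢ b → ⊢ b ∷ Γ ⇛ Δ → ⊢ a ∷ Γ ⇛ Δ
  cut-head {a} {Γ = Γ} a⊢b d = exch (↭-sym (∷↭∷ʳ a Γ)) (cut a⊢b d)

  ⊥-⊢ : ⊥ᶠ ⊢ a
  ⊥-⊢ = wR ⊥ax

  ⊢-⊤ : a ⊢ ⊤ᶠ
  ⊢-⊤ = wL ⊤ax

  ∧-fst : a ∧ᶠ b ⊢ a
  ∧-fst = ∧L₁ ax

  ∧-snd : a ∧ᶠ b ⊢ b
  ∧-snd = ∧L₂ ax

  ∧-pair : ⊢ a ∷ b ∷ [] ⇛ just (a ∧ᶠ b)
  ∧-pair = ∧R (exch-head (wL ax)) (wL ax)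

  ∧-merge : ⊢ a ∷ b ∷ [] ⇛ Δ → ⊢ (a ∧ᶠ b) ∷ [] ⇛ Δ
  ∧-merge d = ctr (cut-head ∧-snd (exch-head (cut-head ∧-fst d)))

  ∧-split : ⊢ (a ∧ᶠ b) ∷ [] ⇛ Δ → ⊢ a ∷ b ∷ [] ⇛ Δ
  ∧-split = cut ∧-pair

  cut₂ : x ⊢ a → x ⊢ b → ⊢ a ∷ b ∷ [] ⇛ Δ → ⊢ x ∷ [] ⇛ Δ
  cut₂ x⊢a x⊢b d = cut (∧R x⊢a x⊢b) (∧-merge d)

  ∧-mono : a ⊢ b → c ⊢ d → a ∧ᶠ c ⊢ b ∧ᶠ d
  ∧-mono a⊢b c⊢d = ∧R (⊢-trans ∧-fst a⊢b) (⊢-trans ∧-snd c⊢d)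

  ∨-mono : a ⊢ b → c ⊢ d → a ∨ᶠ c ⊢ b ∨ᶠ d
  ∨-mono a⊢b c⊢d = ∨L (∨R₁ a⊢b) (∨R₂ c⊢d)

  ∨-medial : (a ∨ᶠ b) ∨ᶠ (c ∨ᶠ d) ⊢ (a ∨ᶠ c) ∨ᶠ (b ∨ᶠ d)
  ∨-medial = ∨L (∨-mono (∨R₁ ax) (∨R₁ ax)) (∨-mono (∨R₂ ax) (∨R₂ ax))

  ∇-∨ : ∇ᶠ a ∨ᶠ ∇ᶠ b ⊢ ∇ᶠ (a ∨ᶠ b)
  ∇-∨ = ∨L (∇mon (∨R₁ ax)) (∇mon (∨R₂ ax))

  ⋀ᶠ : List Formula → Formula
  ⋀ᶠ = foldr _∧ᶠ_ ⊤ᶠ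

  ⋀ᶠ-intro : ∀ Γ → ⊢ Γ ⇛ just (⋀ᶠ Γ)
  ⋀ᶠ-intro []      = ⊤ax
  ⋀ᶠ-intro (a ∷ Γ) = ∧R (weaken-tail Γ ax) (wL (⋀ᶠ-intro Γ))

  discharge : ∀ Γ → ⊢ x ∷ Γ ⇛ Δ → All (λ a → x ⊢ a) Γ → ⊢ x ∷ [] ⇛ Δ
  discharge []      d []          = d
  discharge (a ∷ Γ) d (x⊢a ∷ x⊢Γ) = discharge Γ (ctr (cut-head x⊢a (exch-head d))) x⊢Γ

  →-eval : ∇ᶠ (a →ᶠ b) ∧ᶠ a ⊢ b
  →-eval = ∧-merge (→L ax (exch-head (wL ax)))

  →-curry : ∇ᶠ c ∧ᶠ a ⊢ b → c ⊢ a →ᶠ b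
  →-curry d = →R (exch-head (∧-split d))

  ∧-∨-distrib : T (Flags.D C) → a ∧ᶠ (b ∨ᶠ c) ⊢ (a ∧ᶠ b) ∨ᶠ (a ∧ᶠ c)
  ∧-∨-distrib δ = ∧-merge (exch-head (ruleD δ (∨R₁ (exch-head ∧-pair)) (∨R₂ (exch-head ∧-pair))))

  ∇-reflects-⊢ : T (Flags.Fu C) → ∇ᶠ a ⊢ ∇ᶠ b → a ⊢ b
  ∇-reflects-⊢ fu ∇a⊢∇b = ⊢-trans (→R (wL ∇a⊢∇b)) (ruleFu fu {Γ = []} ⊤ax ax)

  -- Both implications are residuals, → of c ↦ ∇c ∧ a and ⊃ of c ↦ c ∧ a, so the corresponding
  -- operations on ideals, and their truth lemmas, are obtained once for both.
  record Residuation : Set where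
    field
      _⊗_ _⊸_ : Formula → Formula → Formula
      ⊗-mono  : c ⊢ d → a ⊢ b → c ⊗ a ⊢ d ⊗ b
      ⊸-curry : c ⊗ a ⊢ b → c ⊢ a ⊸ b
      ⊸-eval  : (a ⊸ b) ⊗ a ⊢ b

    ⊗-⊥ : ⊥ᶠ ⊗ a ⊢ ⊥ᶠ
    ⊗-⊥ = ⊢-trans (⊗-mono ⊥-⊢ ax) ⊸-eval

    ⊗-∨ : (c ∨ᶠ d) ⊗ a ⊢ (c ⊗ a) ∨ᶠ (d ⊗ a)
    ⊗-∨ = ⊢-trans (⊗-mono (∨L (⊸-curry (∨R₁ ax)) (⊸-curry (∨R₂ ax))) ax) ⊸-eval

  ∇-residuation : Residuation
  ∇-residuation = record
    { _⊗_     = λ c a → ∇ᶠ c ∧ᶠ a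
    ; _⊸_     = _→ᶠ_
    ; ⊗-mono  = λ c⊢d a⊢b → ∧-mono (∇mon c⊢d) a⊢b
    ; ⊸-curry = →-curry
    ; ⊸-eval  = →-eval
    }

  ∧-residuation : T (Flags.H C) → Residuation
  ∧-residuation h = record
    { _⊗_     = _∧ᶠ_
    ; _⊸_     = imp h
    ; ⊗-mono  = ∧-mono
    ; ⊸-curry = λ d → ⊃R h (exch-head (∧-split d))
    ; ⊸-eval  = ∧-merge (⊃L h ax (exch-head (wL ax)))
    }

module IdealCompletion (C : Flags) {I : Set} (hyp : I → Sequent (Flags.H C)) (ℓ : Level) where
  open DerivedRules C hyp

  private variable
    a b : Formula

  record Ideal : Set (lsuc ℓ) where
    field
      Mem      : Formula → Set ℓ
      ↓-closed : a ⊢ b → Mem b → Mem a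
      ⊥-mem    : Mem ⊥ᶠ
      ∨-closed : Mem a → Mem b → Mem (a ∨ᶠ b)
  open Ideal

  infix 4 _∈_ _≤ᴵ_ _≈ᴵ_
  _∈_ : Formula → Ideal → Set ℓ
  x ∈ X = Mem X x

  _≤ᴵ_ : Ideal → Ideal → Set ℓ
  X ≤ᴵ Y = ∀ {x} → x ∈ X → x ∈ Y

  _≈ᴵ_ : Ideal → Ideal → Set ℓ
  X ≈ᴵ Y = X ≤ᴵ Y × Y ≤ᴵ X

  ↓_ : Formula → Ideal
  ↓ a = record
    { Mem      = λ x → Lift ℓ (x ⊢ a)
    ; ↓-closed = λ x⊢y y⊢a → lift (⊢-trans x⊢y (lower y⊢a))
    ; ⊥-mem    = lift ⊥-⊢
    ; ∨-closed = λ x⊢a y⊢a → lift (∨L (lower x⊢a) (lower y⊢a))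
    }

  ⊤ᴵ : Ideal
  ⊤ᴵ = record { Mem = λ _ → Unit ; ↓-closed = λ _ _ → tt ; ⊥-mem = tt ; ∨-closed = λ _ _ → tt }

  ⊥ᴵ : Ideal
  ⊥ᴵ = ↓ ⊥ᶠ

  _∩_ : Ideal → Ideal → Ideal
  X ∩ Y = record
    { Mem      = λ x → x ∈ X × x ∈ Y
    ; ↓-closed = λ x⊢y (y∈X , y∈Y) → ↓-closed X x⊢y y∈X , ↓-closed Y x⊢y y∈Y
    ; ⊥-mem    = ⊥-mem X , ⊥-mem Y
    ; ∨-closed = λ (a∈X , a∈Y) (b∈X , b∈Y) → ∨-closed X a∈X b∈X , ∨-closed Y a∈Y b∈Y
    }

  _∪_ : Ideal → Ideal → Ideal
  X ∪ Y = record
    { Mem      = λ x → Σ Formula λ a → Σ Formula λ b → a ∈ X × b ∈ Y × Lift ℓ (x ⊢ a ∨ᶠ b)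
    ; ↓-closed = λ { x⊢y (a , b , a∈X , b∈Y , lift y⊢a∨b) →
                     a , b , a∈X , b∈Y , lift (⊢-trans x⊢y y⊢a∨b) }
    ; ⊥-mem    = ⊥ᶠ , ⊥ᶠ , ⊥-mem X , ⊥-mem Y , lift ⊥-⊢
    ; ∨-closed = λ { (a , b , a∈X , b∈Y , lift x⊢a∨b) (a′ , b′ , a′∈X , b′∈Y , lift y⊢a′∨b′) →
                     a ∨ᶠ a′ , b ∨ᶠ b′ , ∨-closed X a∈X a′∈X , ∨-closed Y b∈Y b′∈Y ,
                     lift (⊢-trans (∨-mono x⊢a∨b y⊢a′∨b′) ∨-medial) }
    }

  -- The ideal generated by the union of the X j, built inductively so that it stays in Set ℓ.
  data Generated {J : Set ℓ} (X : J → Ideal) : Formula → Set ℓ where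
    gen-base : ∀ j → a ∈ X j → Generated X a
    gen-↓    : a ⊢ b → Generated X b → Generated X a
    gen-⊥    : Generated X ⊥ᶠ
    gen-∨    : Generated X a → Generated X b → Generated X (a ∨ᶠ b)

  ⋁ᴵ : {J : Set ℓ} → (J → Ideal) → Ideal
  ⋁ᴵ X = record { Mem = Generated X ; ↓-closed = gen-↓ ; ⊥-mem = gen-⊥ ; ∨-closed = gen-∨ }

  ⋁ᴵ-least : {J : Set ℓ} {X : J → Ideal} (U : Ideal) → (∀ j → X j ≤ᴵ U) → ⋁ᴵ X ≤ᴵ U
  ⋁ᴵ-least U X≤U (gen-base j a∈X) = X≤U j a∈X
  ⋁ᴵ-least U X≤U (gen-↓ a⊢b b∈⋁) = ↓-closed U a⊢b (⋁ᴵ-least U X≤U b∈⋁)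
  ⋁ᴵ-least U X≤U gen-⊥            = ⊥-mem U
  ⋁ᴵ-least U X≤U (gen-∨ a∈⋁ b∈⋁)  = ∨-closed U (⋁ᴵ-least U X≤U a∈⋁) (⋁ᴵ-least U X≤U b∈⋁)

  ≈ᴵ-isEquivalence : IsEquivalence _≈ᴵ_
  ≈ᴵ-isEquivalence = record
    { refl  = (λ x∈X → x∈X) , (λ x∈X → x∈X)
    ; sym   = λ (X≤Y , Y≤X) → Y≤X , X≤Y
    ; trans = λ (X≤Y , Y≤X) (Y≤Z , Z≤Y) → (λ x∈X → Y≤Z (X≤Y x∈X)) , (λ x∈Z → Y≤X (Z≤Y x∈Z))
    }

  ≤ᴵ-isPartialOrder : IsPartialOrder _≈ᴵ_ _≤ᴵ_
  ≤ᴵ-isPartialOrder = record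
    { isPreorder = record
      { isEquivalence = ≈ᴵ-isEquivalence
      ; reflexive     = proj₁
      ; trans         = λ X≤Y Y≤Z x∈X → Y≤Z (X≤Y x∈X)
      }
    ; antisym = _,_
    }

  idealLattice : BoundedLattice (lsuc ℓ) ℓ ℓ
  idealLattice = record
    { Carrier = Ideal ; _≈_ = _≈ᴵ_ ; _≤_ = _≤ᴵ_ ; _∨_ = _∪_ ; _∧_ = _∩_ ; ⊤ = ⊤ᴵ ; ⊥ = ⊥ᴵ
    ; isBoundedLattice = record
      { isLattice = record
        { isPartialOrder = ≤ᴵ-isPartialOrder
        ; supremum       = λ X Y →
            (λ {x} x∈X → x , ⊥ᶠ , x∈X , ⊥-mem Y , lift (∨R₁ ax)) ,
            (λ {x} x∈Y → ⊥ᶠ , x , ⊥-mem X , x∈Y , lift (∨R₂ ax)) ,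
            (λ Z X≤Z Y≤Z → λ { (a , b , a∈X , b∈Y , lift x⊢a∨b) →
                                 ↓-closed Z x⊢a∨b (∨-closed Z (X≤Z a∈X) (Y≤Z b∈Y)) })
        ; infimum        = λ X Y → proj₁ , proj₂ , (λ Z Z≤X Z≤Y x∈Z → Z≤X x∈Z , Z≤Y x∈Z)
        }
      ; maximum = λ X _ → tt
      ; minimum = λ X x⊢⊥ → ↓-closed X (lower x⊢⊥) (⊥-mem X)
      }
    }

  ⊤ᴵ≈↓⊤ : ⊤ᴵ ≈ᴵ ↓ ⊤ᶠ
  ⊤ᴵ≈↓⊤ = (λ _ → lift ⊢-⊤) , (λ _ → tt)

  ∩-↓ : ∀ {X Y a b} → X ≈ᴵ ↓ a → Y ≈ᴵ ↓ b → X ∩ Y ≈ᴵ ↓ (a ∧ᶠ b)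
  ∩-↓ (X≤↓a , ↓a≤X) (Y≤↓b , ↓b≤Y) =
    (λ (x∈X , x∈Y) → lift (∧R (lower (X≤↓a x∈X)) (lower (Y≤↓b x∈Y)))) ,
    (λ (lift x⊢a∧b) → ↓a≤X (lift (⊢-trans x⊢a∧b ∧-fst)) , ↓b≤Y (lift (⊢-trans x⊢a∧b ∧-snd)))

  ∪-↓ : ∀ {X Y a b} → X ≈ᴵ ↓ a → Y ≈ᴵ ↓ b → X ∪ Y ≈ᴵ ↓ (a ∨ᶠ b)
  ∪-↓ {a = a} {b} (X≤↓a , ↓a≤X) (Y≤↓b , ↓b≤Y) =
    (λ (a′ , b′ , a′∈X , b′∈Y , lift x⊢a′∨b′) →
       lift (⊢-trans x⊢a′∨b′ (∨-mono (lower (X≤↓a a′∈X)) (lower (Y≤↓b b′∈Y))))) ,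
    (λ x⊢a∨b → a , b , ↓a≤X (lift ax) , ↓b≤Y (lift ax) , x⊢a∨b)

module CanonicalModel (C : Flags) {I : Set} (hyp : I → Sequent (Flags.H C)) (ℓ : Level) where
  open DerivedRules C hyp
  open IdealCompletion C hyp ℓ
  open Ideal

  private variable
    x : Formula

  ∇ᴵ : Ideal → Ideal
  ∇ᴵ Z = record
    { Mem      = λ x → Σ Formula λ z → z ∈ Z × Lift ℓ (x ⊢ ∇ᶠ z)
    ; ↓-closed = λ { x⊢y (z , z∈Z , lift y⊢∇z) → z , z∈Z , lift (⊢-trans x⊢y y⊢∇z) }
    ; ⊥-mem    = ⊥ᶠ , ⊥-mem Z , lift ⊥-⊢
    ; ∨-closed = λ { (z , z∈Z , lift a⊢∇z) (z′ , z′∈Z , lift b⊢∇z′) →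
                     z ∨ᶠ z′ , ∨-closed Z z∈Z z′∈Z , lift (⊢-trans (∨-mono a⊢∇z b⊢∇z′) ∇-∨) }
    }

  residualᴵ : Residuation → Ideal → Ideal → Ideal
  residualᴵ R X Y = record
    { Mem      = λ c → ∀ a → a ∈ X → c ⊗ a ∈ Y
    ; ↓-closed = λ x⊢y y∈X⊸Y a a∈X → ↓-closed Y (⊗-mono x⊢y ax) (y∈X⊸Y a a∈X)
    ; ⊥-mem    = λ _ _ → ↓-closed Y ⊗-⊥ (⊥-mem Y)
    ; ∨-closed = λ c∈X⊸Y d∈X⊸Y a a∈X →
                   ↓-closed Y ⊗-∨ (∨-closed Y (c∈X⊸Y a a∈X) (d∈X⊸Y a a∈X))
    }
    where open Residuation R

  _⇝ᴵ_ : Ideal → Ideal → Ideal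
  _⇝ᴵ_ = residualᴵ ∇-residuation

  ⇝ᴵ-adjoint : ∀ A B Z → (∇ᴵ Z ∩ A ≤ᴵ B → Z ≤ᴵ A ⇝ᴵ B) × (Z ≤ᴵ A ⇝ᴵ B → ∇ᴵ Z ∩ A ≤ᴵ B)
  ⇝ᴵ-adjoint A B Z =
    (λ ∇Z∩A≤B z∈Z _ a∈A → ∇Z∩A≤B ((_ , z∈Z , lift ∧-fst) , ↓-closed A ∧-snd a∈A)) ,
    (λ { Z≤A⇝B ((z , z∈Z , lift x⊢∇z) , x∈A) →
           ↓-closed B (∧R x⊢∇z ax) (Z≤A⇝B z∈Z _ x∈A) })

  canonical : NablaAlgebra (lsuc ℓ) ℓ ℓ
  canonical = record { boundedLattice = idealLattice ; ∇ = ∇ᴵ ; _⇝_ = _⇝ᴵ_ ; adj = ⇝ᴵ-adjoint }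

  canonical-complete : IsComplete ℓ canonical
  canonical-complete X = ⋁ᴵ X , (λ j → gen-base j) , ⋁ᴵ-least

  canonical-N : T (Flags.N C) → (∇ᴵ ⊤ᴵ ≈ᴵ ⊤ᴵ) × (∀ X Y → ∇ᴵ (X ∩ Y) ≈ᴵ ∇ᴵ X ∩ ∇ᴵ Y)
  canonical-N n = ((λ _ → tt) , (λ _ → ⊤ᶠ , tt , lift (wL (ruleN n ⊤ax)))) , ∇ᴵ-∩
    where
    ∇ᴵ-∩ : ∀ X Y → ∇ᴵ (X ∩ Y) ≈ᴵ ∇ᴵ X ∩ ∇ᴵ Y
    ∇ᴵ-∩ X Y =
      (λ { (z , (z∈X , z∈Y) , x⊢∇z) → (z , z∈X , x⊢∇z) , (z , z∈Y , x⊢∇z) }) ,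
      (λ { ((z , z∈X , lift x⊢∇z) , (z′ , z′∈Y , lift x⊢∇z′)) →
             z ∧ᶠ z′ , (↓-closed X ∧-fst z∈X , ↓-closed Y ∧-snd z′∈Y) ,
             lift (cut₂ x⊢∇z x⊢∇z′ (ruleN n ∧-pair)) })

  canonical-H : T (Flags.H C) → Σ (Ideal → Ideal → Ideal) λ _⊃_ →
                ∀ A B Z → (Z ∩ A ≤ᴵ B → Z ≤ᴵ A ⊃ B) × (Z ≤ᴵ A ⊃ B → Z ∩ A ≤ᴵ B)
  canonical-H h = residualᴵ (∧-residuation h) , λ A B Z →
    (λ Z∩A≤B z∈Z _ a∈A → Z∩A≤B (↓-closed Z ∧-fst z∈Z , ↓-closed A ∧-snd a∈A)) ,
    (λ { Z≤A⊃B (x∈Z , x∈A) → ↓-closed B (∧R ax ax) (Z≤A⊃B x∈Z _ x∈A) })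

  canonical-D : T (Flags.D C) → ∀ X Y Z → X ∩ (Y ∪ Z) ≤ᴵ (X ∩ Y) ∪ (X ∩ Z)
  canonical-D δ X Y Z {x} (x∈X , b , c , b∈Y , c∈Z , lift x⊢b∨c) =
    x ∧ᶠ b , x ∧ᶠ c ,
    (↓-closed X ∧-fst x∈X , ↓-closed Y ∧-snd b∈Y) ,
    (↓-closed X ∧-fst x∈X , ↓-closed Z ∧-snd c∈Z) ,
    lift (⊢-trans (∧R ax x⊢b∨c) (∧-∨-distrib δ))

  canonical-R : T (Flags.R C) → ∀ X → X ≤ᴵ ∇ᴵ X
  canonical-R r X x∈X = _ , x∈X , lift (ruleR r ax)

  canonical-L : T (Flags.L C) → ∀ X → ∇ᴵ X ≤ᴵ X
  canonical-L l X (z , z∈X , lift x⊢∇z) = ↓-closed X (⊢-trans x⊢∇z (ruleL l ax)) z∈X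

  canonical-Fa : T (Flags.Fa C) → ∀ Y → Σ Ideal λ X → ∇ᴵ X ≈ᴵ Y
  canonical-Fa fa Y = ⊤ᴵ ⇝ᴵ Y , ∇[⊤⇝Y]≤Y , Y≤∇[⊤⇝Y]
    where
    ∇[⊤⇝Y]≤Y : ∇ᴵ (⊤ᴵ ⇝ᴵ Y) ≤ᴵ Y
    ∇[⊤⇝Y]≤Y (c , c∈⊤⇝Y , lift x⊢∇c) = ↓-closed Y (∧R x⊢∇c ⊢-⊤) (c∈⊤⇝Y ⊤ᶠ tt)

    Y≤∇[⊤⇝Y] : Y ≤ᴵ ∇ᴵ (⊤ᴵ ⇝ᴵ Y)
    Y≤∇[⊤⇝Y] {y} y∈Y =
      ⊤ᶠ →ᶠ y , (λ _ _ → ↓-closed Y (⊢-trans (∧-mono ax ⊢-⊤) →-eval) y∈Y) , lift (ruleFa fa (wL ax))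

  canonical-Fu : T (Flags.Fu C) → ∀ Y → Σ Ideal λ X → ⊤ᴵ ⇝ᴵ X ≈ᴵ Y
  canonical-Fu fu Y = ∇ᴵ Y , ⊤⇝∇Y≤Y , (λ y∈Y _ _ → _ , y∈Y , lift ∧-fst)
    where
    ⊤⇝∇Y≤Y : ⊤ᴵ ⇝ᴵ ∇ᴵ Y ≤ᴵ Y
    ⊤⇝∇Y≤Y x∈⊤⇝∇Y with x∈⊤⇝∇Y ⊤ᶠ tt
    ... | y , y∈Y , lift ∇x∧⊤⊢∇y = ↓-closed Y (∇-reflects-⊢ fu (⊢-trans (∧R ax ⊢-⊤) ∇x∧⊤⊢∇y)) y∈Y

  canonical-inV : InV C canonical
  canonical-inV = record
    { propN  = canonical-N
    ; propH  = canonical-H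
    ; propD  = canonical-D
    ; propR  = canonical-R
    ; propL  = canonical-L
    ; propFa = canonical-Fa
    ; propFu = canonical-Fu
    }

  residualᴵ-↓ : ∀ R {X Y a b} → X ≈ᴵ ↓ a → Y ≈ᴵ ↓ b → residualᴵ R X Y ≈ᴵ ↓ Residuation._⊸_ R a b
  residualᴵ-↓ R {a = a} (X≤↓a , ↓a≤X) (Y≤↓b , ↓b≤Y) =
    (λ c∈X⊸Y → lift (⊸-curry (lower (Y≤↓b (c∈X⊸Y a (↓a≤X (lift ax))))))) ,
    (λ (lift x⊢a⊸b) a′ a′∈X → ↓b≤Y (lift (⊢-trans (⊗-mono x⊢a⊸b (lower (X≤↓a a′∈X))) ⊸-eval)))
    where open Residuation R

  ∇ᴵ-↓ : ∀ {X a} → X ≈ᴵ ↓ a → ∇ᴵ X ≈ᴵ ↓ ∇ᶠ a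
  ∇ᴵ-↓ {a = a} (X≤↓a , ↓a≤X) =
    (λ (z , z∈X , lift x⊢∇z) → lift (⊢-trans x⊢∇z (∇mon (lower (X≤↓a z∈X))))) ,
    (λ x⊢∇a → a , ↓a≤X (lift ax) , x⊢∇a)

  valuation : ℕ → Ideal
  valuation n = ↓ var n

  open Semantics canonical canonical-inV valuation
  open BoundedLatticeProperties idealLattice using (⨅)

  truth : ∀ A → ⟦ A ⟧ ≈ᴵ ↓ A
  truth (var n)     = id , id
  truth ⊤ᶠ          = ⊤ᴵ≈↓⊤
  truth ⊥ᶠ          = id , id
  truth (A ∧ᶠ B)    = ∩-↓ {⟦ A ⟧} {⟦ B ⟧} (truth A) (truth B)
  truth (A ∨ᶠ B)    = ∪-↓ {⟦ A ⟧} {⟦ B ⟧} (truth A) (truth B)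
  truth (A →ᶠ B)    = residualᴵ-↓ ∇-residuation {⟦ A ⟧} {⟦ B ⟧} (truth A) (truth B)
  truth (∇ᶠ A)      = ∇ᴵ-↓ {⟦ A ⟧} (truth A)
  truth (imp h A B) = residualᴵ-↓ (∧-residuation h) {⟦ A ⟧} {⟦ B ⟧} (truth A) (truth B)

  succedent-truth : ∀ Δ {x} →
                    (x ∈ maybe ⟦_⟧ ⊥ᴵ Δ → ⊢ x ∷ [] ⇛ Δ) × (⊢ x ∷ [] ⇛ Δ → x ∈ maybe ⟦_⟧ ⊥ᴵ Δ)
  succedent-truth (just B) =
    (λ x∈⟦B⟧ → lower (proj₁ (truth B) x∈⟦B⟧)) , (λ x⊢B → proj₂ (truth B) (lift x⊢B))
  succedent-truth nothing  = (λ x⊢⊥ → cut (lower x⊢⊥) ⊥ax) , (λ ⊢x⇛ → lift (wR ⊢x⇛))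

  ∈⨅⟦⟧⇒⊢ : ∀ Γ → x ∈ ⨅ ⟦_⟧ Γ → All (λ a → x ⊢ a) Γ
  ∈⨅⟦⟧⇒⊢ []      _               = []
  ∈⨅⟦⟧⇒⊢ (a ∷ Γ) (x∈⟦a⟧ , x∈⟦Γ⟧) = lower (proj₁ (truth a) x∈⟦a⟧) ∷ ∈⨅⟦⟧⇒⊢ Γ x∈⟦Γ⟧

  ⋀ᶠ∈⨅⟦⟧ : ∀ Γ → ⋀ᶠ Γ ∈ ⨅ ⟦_⟧ Γ
  ⋀ᶠ∈⨅⟦⟧ []      = tt
  ⋀ᶠ∈⨅⟦⟧ (a ∷ Γ) = proj₂ (truth a) (lift ∧-fst) , ↓-closed (⨅ ⟦_⟧ Γ) ∧-snd (⋀ᶠ∈⨅⟦⟧ Γ)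

  derivable⇒holds : ∀ S → ⊢ S → Holds S
  derivable⇒holds (Γ ⇛ Δ) ⊢S x∈⟦Γ⟧ =
    proj₂ (succedent-truth Δ) (discharge Γ (wL ⊢S) (∈⨅⟦⟧⇒⊢ Γ x∈⟦Γ⟧))

  holds⇒derivable : ∀ S → Holds S → ⊢ S
  holds⇒derivable (Γ ⇛ Δ) ⟦Γ⟧≤⟦Δ⟧ =
    cut (⋀ᶠ-intro Γ) (proj₁ (succedent-truth Δ) (⟦Γ⟧≤⟦Δ⟧ (⋀ᶠ∈⨅⟦⟧ Γ)))

  completeness : ∀ S → SemCons ℓ C hyp S → ⊢ S
  completeness S ⊨S =
    holds⇒derivable S (⊨S canonical canonical-complete canonical-inV valuation hyps-hold)
    where
    hyps-hold : ∀ i → Holds (hyp i)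
    hyps-hold i = derivable⇒holds (hyp i) (hyp′ i)

corollary6p11 : (ℓ : Level) (C : Flags) {I : Set} (hyp : I → Sequent (Flags.H C))
                (S : Sequent (Flags.H C)) →
                (Deriv C hyp S → SemCons ℓ C hyp S) × (SemCons ℓ C hyp S → Deriv C hyp S)
corollary6p11 ℓ C hyp S =
  (λ ⊢S 𝔸 _ inV v hyps → Soundness.sound 𝔸 inV v hyps ⊢S) ,
  CanonicalModel.completeness C hyp ℓ S
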